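{- Let $n\ge 3$, $m\ge 3$, identify $V(K_n)=[n]$, $V(K_m)=[m]$, so $V(K_n\,\square\, K_m)=[n]\times[m]$, and let $X$ be a general position set of $K_n\,\square\, K_m$ of maximum cardinality. Then there exist $i\in[n]$ and $j\in[m]$ such that $$X = \big(([n]\times\{j\})\cup(\{i\}\times[m])\big)\setminus\{(i,j)\}.$$
   Context: A set $S\subseteq V(G)$ is a general position set if no three vertices of $S$ lie on a common shortest path of $G$. $K_n\,\square\, K_m$ is the Cartesian product of complete graphs: $(a,b)\sim(a',b')$ iff exactly one coordinate differs. $[n]=\{1,\dots,n\}$. -}

module Defs where

open import Data.Nat using (ℕ; zero; suc; _≤_)
open import Data.Fin using (Fin)
open import Data.Product using (_×_; _,_; Σ; ∃; proj₁; proj₂)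
open import Data.Sum using (_⊎_)
open import Data.List using (List; length)
open import Data.List.Membership.Propositional using (_∈_)
open import Data.List.Relation.Unary.Unique.Propositional using (Unique)
open import Relation.Binary.PropositionalEquality using (_≡_; _≢_)
open import Relation.Nullary using (¬_)

Vertex : ℕ → ℕ → Set
Vertex n m = Fin n × Fin m

Adj : ∀ {n m} → Vertex n m → Vertex n m → Set
Adj (a , b) (a' , b') = (a ≡ a' × b ≢ b') ⊎ (a ≢ a' × b ≡ b')

data Walk {n m : ℕ} : Vertex n m → Vertex n m → Set where
  stop : (u : Vertex n m) → Walk u u
  step : ∀ {u w v} → Adj u w → Walk w v → Walk u v

len : ∀ {n m} {u v : Vertex n m} → Walk u v → ℕ
len (stop _)   = 0
len (step _ p) = suc (len p)

data OnWalk {n m : ℕ} (x : Vertex n m) : {u v : Vertex n m} → Walk u v → Set where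
  here-stop : OnWalk x (stop x)
  here-step : ∀ {w v} (e : Adj x w) (p : Walk w v) → OnWalk x (step e p)
  there     : ∀ {u w v} (e : Adj u w) {p : Walk w v} → OnWalk x p → OnWalk x (step e p)

IsShortest : ∀ {n m} {u v : Vertex n m} → Walk u v → Set
IsShortest {u = u} {v = v} p = (q : Walk u v) → len p ≤ len q

OnCommonGeodesic : ∀ {n m} → Vertex n m → Vertex n m → Vertex n m → Set
OnCommonGeodesic {n} {m} x y z =
  Σ (Vertex n m) λ u → Σ (Vertex n m) λ v → Σ (Walk u v) λ p →
    IsShortest p × OnWalk x p × OnWalk y p × OnWalk z p

-- A finite vertex set is a duplicate-free list of vertices; |S| = length S.
-- General position set: no three (distinct) vertices of S on a common shortest path.
IsGeneralPosition : ∀ {n m} → List (Vertex n m) → Set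
IsGeneralPosition S =
  Unique S ×
  (∀ {x y z} → x ∈ S → y ∈ S → z ∈ S → x ≢ y → y ≢ z → x ≢ z →
     ¬ OnCommonGeodesic x y z)

IsMaxGeneralPosition : ∀ {n m} → List (Vertex n m) → Set
IsMaxGeneralPosition {n} {m} S =
  IsGeneralPosition S ×
  ((T : List (Vertex n m)) → IsGeneralPosition T → length T ≤ length S)

{-# OPTIONS --safe #-}

-- A vertex set S of K_n □ K_m is in general position iff every point of S is the only point of S
-- in its row or the only one in its column: geodesics have length at most 2, and a geodesic
-- through three points of S is an L whose corner has a row-mate and a column-mate in S.
-- Sending each point of such an S to its row if it is alone there, and to its column otherwise,
-- is injective, so |S| plus the number of lines not hit is at most n + m.  A punctured cross
-- shows |X| ≥ n + m − 2 for a maximum X, so at most two lines are missed; examining which ones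
-- forces X into a punctured cross, and maximality fills it.

module Submission where

open import Defs
open import Data.Empty using (⊥; ⊥-elim)
open import Data.Fin using (Fin; zero; suc; join; splitAt)
open import Data.Fin.Properties using (_≟_; splitAt-join; suc-injective)
open import Data.List using (List; []; _∷_; length; map; _++_; allFin)
open import Data.List.Membership.Propositional using (_∈_; _∉_; find; lose)
open import Data.List.Membership.Propositional.Properties using (∈-map⁺; ∈-map⁻; ∈-++⁻; ∈-allFin)
import Data.List.Membership.DecPropositional as DecMembership
open import Data.List.Properties using (length-map; length-++; length-tabulate; length-removeAt′)
open import Data.List.Relation.Binary.Subset.Propositional using (_⊆_)
open import Data.List.Relation.Unary.All as All using (All; []; _∷_)
import Data.List.Relation.Unary.All.Properties as Allₚ
open import Data.List.Relation.Unary.Any using (here; there; _─_; any?)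
open import Data.List.Relation.Unary.Unique.Propositional using (Unique; []; _∷_)
import Data.List.Relation.Unary.Unique.Propositional.Properties as Unique
open import Data.Nat using (ℕ; suc; _+_; _≤_; _<_; z≤n; s≤s)
open import Data.Nat.Properties
  using (≤-trans; ≤-refl; ≤-reflexive; ≤⇒≯; 1+n≰n; n≤1+n; +-suc; module ≤-Reasoning)
open import Data.Product using (_×_; _,_; Σ; ∃-syntax; proj₁; proj₂)
open import Data.Product.Properties using (×-≡,≡→≡) renaming (≡-dec to ×-≡-dec)
open import Data.Sum using (_⊎_; inj₁; inj₂; [_,_]′)
open import Data.Sum.Properties using (inj₁-injective; inj₂-injective) renaming (≡-dec to ⊎-≡-dec)
open import Function using (id; _∘_)
open import Function.Bundles using (_⇔_; mk⇔)
open import Relation.Binary.Definitions using (DecidableEquality)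
open import Relation.Binary.PropositionalEquality
  using (_≡_; _≢_; refl; sym; trans; cong; cong₂; subst; ≢-sym; module ≡-Reasoning)
open import Relation.Nullary using (¬_; Dec; yes; no; contradiction)
open import Relation.Nullary.Decidable using (decidable-stable; map′; _×-dec_; ¬?)

module _ {A : Set} where

  ∈-─⁺ : ∀ {x y : A} {ys} (x∈ys : x ∈ ys) → y ∈ ys → y ≢ x → y ∈ (ys ─ x∈ys)
  ∈-─⁺ (here refl)  (here refl)  y≢x = contradiction refl y≢x
  ∈-─⁺ (here _)     (there y∈ys) _   = y∈ys
  ∈-─⁺ (there _)    (here refl)  _   = here refl
  ∈-─⁺ (there x∈ys) (there y∈ys) y≢x = there (∈-─⁺ x∈ys y∈ys y≢x)

  unique⊆⇒length≤ : ∀ {xs ys : List A} → Unique xs → xs ⊆ ys → length xs ≤ length ys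
  unique⊆⇒length≤ []                        _     = z≤n
  unique⊆⇒length≤ {ys = ys} (x∉xs ∷ uxs) xs⊆ys =
    ≤-trans (s≤s (unique⊆⇒length≤ uxs xs⊆ys─x)) (≤-reflexive (sym (length-removeAt′ ys _)))
    where
    xs⊆ys─x : _ ⊆ (ys ─ xs⊆ys (here refl))
    xs⊆ys─x y∈xs = ∈-─⁺ _ (xs⊆ys (there y∈xs)) (≢-sym (All.lookup x∉xs y∈xs))

  module _ (_≟ᴬ_ : DecidableEquality A) where
    open DecMembership _≟ᴬ_ using (_∈?_)

    ∃-∉-pigeonhole : ∀ {xs ys : List A} → Unique xs → length ys < length xs →
                     ∃[ x ] x ∈ xs × x ∉ ys
    ∃-∉-pigeonhole {xs} {ys} uxs ys<xs with any? (λ x → ¬? (x ∈? ys)) xs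
    ... | yes some = find some
    ... | no  none = ⊥-elim (≤⇒≯ (unique⊆⇒length≤ uxs xs⊆ys) ys<xs)
      where
      xs⊆ys : xs ⊆ ys
      xs⊆ys x∈xs = decidable-stable (_ ∈? ys) (none ∘ lose x∈xs)

    ⊆-pigeonhole : ∀ {xs ys : List A} → Unique xs → xs ⊆ ys → length ys ≤ length xs → ys ⊆ xs
    ⊆-pigeonhole {xs} {ys} uxs xs⊆ys ys≤xs {y} y∈ys = decidable-stable (y ∈? xs) λ y∉xs →
      ≤⇒≯ ys≤xs (begin-strict
        length xs           ≤⟨ unique⊆⇒length≤ uxs (λ x∈xs →
                                 ∈-─⁺ y∈ys (xs⊆ys x∈xs) λ { refl → y∉xs x∈xs }) ⟩
        length (ys ─ y∈ys)  <⟨ ≤-reflexive (sym (length-removeAt′ ys _)) ⟩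
        length ys           ∎)
      where open ≤-Reasoning

map⁺-injectiveOn : ∀ {A B : Set} {f : A → B} {xs} →
                   (∀ {x y} → x ∈ xs → y ∈ xs → f x ≡ f y → x ≡ y) →
                   Unique xs → Unique (map f xs)
map⁺-injectiveOn _   []           = []
map⁺-injectiveOn inj (x∉xs ∷ uxs) =
  Allₚ.map⁺ (All.tabulate λ y∈xs fx≡fy → All.lookup x∉xs y∈xs (inj (here refl) (there y∈xs) fx≡fy))
  ∷ map⁺-injectiveOn (λ x∈ y∈ → inj (there x∈) (there y∈)) uxs

length-allFin : ∀ n → length (allFin n) ≡ n
length-allFin n = length-tabulate id

unique⇒length≤ : ∀ {n} {xs : List (Fin n)} → Unique xs → length xs ≤ n
unique⇒length≤ {n} {xs} uxs =
  subst (length xs ≤_) (length-allFin n) (unique⊆⇒length≤ uxs (λ {k} _ → ∈-allFin k))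

unique⊎⇒length≤ : ∀ {n m} {xs : List (Fin n ⊎ Fin m)} → Unique xs → length xs ≤ n + m
unique⊎⇒length≤ {n} {m} {xs} uxs =
  subst (_≤ n + m) (length-map (join n m) xs) (unique⇒length≤ (Unique.map⁺ join-injective uxs))
  where
  join-injective : ∀ {a b} → join n m a ≡ join n m b → a ≡ b
  join-injective {a} {b} eq =
    trans (sym (splitAt-join n m a)) (trans (cong (splitAt n) eq) (splitAt-join n m b))

inj₁-≢ : ∀ {A B : Set} {a b : A} → a ≢ b → inj₁ {B = B} a ≢ inj₁ b
inj₁-≢ a≢b = a≢b ∘ inj₁-injective

inj₂-≢ : ∀ {A B : Set} {a b : B} → a ≢ b → inj₂ {A = A} a ≢ inj₂ b
inj₂-≢ a≢b = a≢b ∘ inj₂-injective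

avoid₂ : ∀ {k} (a b : Fin (3 + k)) → ∃[ c ] c ≢ a × c ≢ b
avoid₂ a b
  with c , _ , c∉ab ← ∃-∉-pigeonhole _≟_ {xs = zero ∷ suc zero ∷ suc (suc zero) ∷ []} {ys = a ∷ b ∷ []}
                        (((λ ()) ∷ (λ ()) ∷ []) ∷ ((λ ()) ∷ []) ∷ [] ∷ []) ≤-refl
  = c , c∉ab ∘ here , λ c≡b → c∉ab (there (here c≡b))

two-others : ∀ {k} (a : Fin (3 + k)) → ∃[ b ] ∃[ c ] a ≢ b × b ≢ c × a ≢ c
two-others a with b , b≢a , _ ← avoid₂ a a with c , c≢a , c≢b ← avoid₂ a b
  = b , c , ≢-sym b≢a , ≢-sym c≢b , ≢-sym c≢a

module _ {A B : Set} (π : A → B) where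

  Alone : List A → A → Set
  Alone S p = ∀ {q} → q ∈ S → π q ≡ π p → q ≡ p

  Mate : List A → A → Set
  Mate S p = ∃[ q ] q ∈ S × π q ≡ π p × q ≢ p

  mate⇒¬alone : ∀ {S p} → Mate S p → ¬ Alone S p
  mate⇒¬alone (q , q∈S , πq≡πp , q≢p) alone = q≢p (alone q∈S πq≡πp)

  module _ (_≟ᴬ_ : DecidableEquality A) where

    ¬mate⇒alone : ∀ {S p} → ¬ Mate S p → Alone S p
    ¬mate⇒alone {p = p} ¬mate {q} q∈S πq≡πp =
      decidable-stable (q ≟ᴬ p) λ q≢p → ¬mate (q , q∈S , πq≡πp , q≢p)

    mate? : DecidableEquality B → ∀ S p → Dec (Mate S p)
    mate? _≟ᴮ_ S p = map′ find (λ (q , q∈S , h) → lose q∈S h)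
      (any? (λ q → (π q ≟ᴮ π p) ×-dec ¬? (q ≟ᴬ p)) S)

module _ {n m : ℕ} where

  _≟ᵥ_ : DecidableEquality (Vertex n m)
  _≟ᵥ_ = ×-≡-dec _≟_ _≟_

  rowMate? : ∀ S p → Dec (Mate proj₁ S p)
  rowMate? = mate? proj₁ _≟ᵥ_ _≟_

  colMate? : ∀ S p → Dec (Mate proj₂ S p)
  colMate? = mate? proj₂ _≟ᵥ_ _≟_

  LineAlone : List (Vertex n m) → Set
  LineAlone S = ∀ {p} → p ∈ S → Alone proj₁ S p ⊎ Alone proj₂ S p

  lineAlone⇒¬mates : ∀ {S p} → LineAlone S → p ∈ S → Mate proj₁ S p → Mate proj₂ S p → ⊥
  lineAlone⇒¬mates lineAlone p∈S rowMate colMate =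
    [ mate⇒¬alone proj₁ rowMate , mate⇒¬alone proj₂ colMate ]′ (lineAlone p∈S)

  Collinear : Vertex n m → Vertex n m → Set
  Collinear u v = proj₁ u ≡ proj₁ v ⊎ proj₂ u ≡ proj₂ v

  adj⇒collinear : ∀ {u v} → Adj u v → Collinear u v
  adj⇒collinear (inj₁ (u₁≡v₁ , _)) = inj₁ u₁≡v₁
  adj⇒collinear (inj₂ (_ , u₂≡v₂)) = inj₂ u₂≡v₂

  prepend : ∀ {u v t} → Collinear u v → (q : Walk v t) → Σ (Walk u t) λ q′ → len q′ ≤ suc (len q)
  prepend {a , b} {a′ , b′} collinear q with a ≟ a′ | b ≟ b′
  ... | yes refl | yes refl = q , n≤1+n _
  ... | yes refl | no b≢b′  = step (inj₁ (refl , b≢b′)) q , ≤-refl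
  ... | no a≢a′  | yes refl = step (inj₂ (a≢a′ , refl)) q , ≤-refl
  ... | no a≢a′  | no b≢b′  = ⊥-elim ([ a≢a′ , b≢b′ ]′ collinear)

  walk≤1 : ∀ {u v} → Collinear u v → Σ (Walk u v) λ q → len q ≤ 1
  walk≤1 collinear = prepend collinear (stop _)

  walk≤2 : ∀ u v → Σ (Walk u v) λ q → len q ≤ 2
  walk≤2 u v with q , q≤1 ← walk≤1 {u = proj₁ u , proj₂ v} (inj₂ refl)
             with q′ , q′≤ ← prepend (inj₁ refl) q
    = q′ , ≤-trans q′≤ (s≤s q≤1)

  ¬collinear⇒2≤len : ∀ {u v} → ¬ Collinear u v → (q : Walk u v) → 2 ≤ len q
  ¬collinear⇒2≤len ¬collinear (stop _)            = contradiction (inj₁ refl) ¬collinear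
  ¬collinear⇒2≤len ¬collinear (step e (stop _))   = contradiction (adj⇒collinear e) ¬collinear
  ¬collinear⇒2≤len _          (step _ (step _ _)) = s≤s (s≤s z≤n)

  shortest⇒len≤2 : ∀ {u v} {p : Walk u v} → IsShortest p → len p ≤ 2
  shortest⇒len≤2 {u} {v} shortest = ≤-trans (shortest (proj₁ (walk≤2 u v))) (proj₂ (walk≤2 u v))

  shortest⇒¬collinear : ∀ {u v} {p : Walk u v} → IsShortest p → 2 ≤ len p → ¬ Collinear u v
  shortest⇒¬collinear shortest 2≤len collinear with q , q≤1 ← walk≤1 collinear =
    1+n≰n (≤-trans 2≤len (≤-trans (shortest q) q≤1))

  vertices : ∀ {u v} → Walk u v → List (Vertex n m)
  vertices (stop u)           = u ∷ []
  vertices (step {u = u} _ p) = u ∷ vertices p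

  onWalk⇒∈vertices : ∀ {x u v} {p : Walk u v} → OnWalk x p → x ∈ vertices p
  onWalk⇒∈vertices here-stop       = here refl
  onWalk⇒∈vertices (here-step _ _) = here refl
  onWalk⇒∈vertices (there _ x-on)  = there (onWalk⇒∈vertices x-on)

  lineAlone⇒¬corner : ∀ {S u w v} → LineAlone S → Adj u w → Adj w v → ¬ Collinear u v →
                      u ∈ S → w ∈ S → v ∈ S → ⊥
  lineAlone⇒¬corner _ (inj₁ (u₁≡w₁ , _)) (inj₁ (w₁≡v₁ , _)) ¬collinear _ _ _ =
    ¬collinear (inj₁ (trans u₁≡w₁ w₁≡v₁))
  lineAlone⇒¬corner _ (inj₂ (_ , u₂≡w₂)) (inj₂ (_ , w₂≡v₂)) ¬collinear _ _ _ =
    ¬collinear (inj₂ (trans u₂≡w₂ w₂≡v₂))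
  lineAlone⇒¬corner lineAlone (inj₁ (u₁≡w₁ , u₂≢w₂)) (inj₂ (w₁≢v₁ , w₂≡v₂)) _ u∈S w∈S v∈S =
    lineAlone⇒¬mates lineAlone w∈S (_ , u∈S , u₁≡w₁ , u₂≢w₂ ∘ cong proj₂)
                                   (_ , v∈S , sym w₂≡v₂ , w₁≢v₁ ∘ sym ∘ cong proj₁)
  lineAlone⇒¬corner lineAlone (inj₂ (u₁≢w₁ , u₂≡w₂)) (inj₁ (w₁≡v₁ , w₂≢v₂)) _ u∈S w∈S v∈S =
    lineAlone⇒¬mates lineAlone w∈S (_ , v∈S , sym w₁≡v₁ , w₂≢v₂ ∘ sym ∘ cong proj₂)
                                   (_ , u∈S , u₂≡w₂ , u₁≢w₁ ∘ cong proj₁)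

  lineAlone⇒generalPosition : ∀ {S} → Unique S → LineAlone S → IsGeneralPosition S
  lineAlone⇒generalPosition {S} uS lineAlone = uS , no-geodesic
    where
    no-geodesic : ∀ {x y z} → x ∈ S → y ∈ S → z ∈ S → x ≢ y → y ≢ z → x ≢ z →
                  ¬ OnCommonGeodesic x y z
    no-geodesic {x} {y} {z} x∈S y∈S z∈S x≢y y≢z x≢z (_ , _ , p , shortest , x-on , y-on , z-on) =
      on-geodesic p shortest
        (All.lookup (onWalk⇒∈vertices x-on ∷ onWalk⇒∈vertices y-on ∷ onWalk⇒∈vertices z-on ∷ []))
      where
      xyz : List (Vertex n m)
      xyz = x ∷ y ∷ z ∷ []

      unique-xyz : Unique xyz
      unique-xyz = (x≢y ∷ x≢z ∷ []) ∷ (y≢z ∷ []) ∷ [] ∷ []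

      xyz⊆S : xyz ⊆ S
      xyz⊆S = All.lookup (x∈S ∷ y∈S ∷ z∈S ∷ [])

      on-geodesic : ∀ {u v} (p : Walk u v) → IsShortest p → xyz ⊆ vertices p → ⊥
      on-geodesic (stop _) _ xyz⊆p
        with s≤s () ← unique⊆⇒length≤ unique-xyz xyz⊆p
      on-geodesic (step _ (stop _)) _ xyz⊆p
        with s≤s (s≤s ()) ← unique⊆⇒length≤ unique-xyz xyz⊆p
      on-geodesic p@(step _ (step _ (step _ _))) shortest _
        with s≤s (s≤s ()) ← shortest⇒len≤2 {p = p} shortest
      on-geodesic p@(step e (step e′ (stop _))) shortest xyz⊆p =
        lineAlone⇒¬corner lineAlone e e′ (shortest⇒¬collinear {p = p} shortest ≤-refl)
          (p⊆S (here refl)) (p⊆S (there (here refl))) (p⊆S (there (there (here refl))))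
        where
        p⊆S : vertices p ⊆ S
        p⊆S = xyz⊆S ∘ ⊆-pigeonhole _≟ᵥ_ unique-xyz xyz⊆p ≤-refl

  generalPosition⇒lineAlone : ∀ {S} → IsGeneralPosition S → LineAlone S
  generalPosition⇒lineAlone {S} (_ , no-geodesic) {p} p∈S with rowMate? S p | colMate? S p
  ... | no ¬rowMate | _           = inj₁ (¬mate⇒alone proj₁ _≟ᵥ_ ¬rowMate)
  ... | yes _       | no ¬colMate = inj₂ (¬mate⇒alone proj₂ _≟ᵥ_ ¬colMate)
  ... | yes (q , q∈S , q₁≡p₁ , q≢p) | yes (r , r∈S , r₂≡p₂ , r≢p) =
    ⊥-elim (no-geodesic q∈S p∈S r∈S q≢p (≢-sym r≢p) (λ { refl → ¬collinear (inj₁ refl) })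
      (q , r , qpr , ¬collinear⇒2≤len ¬collinear ,
       here-step _ _ , there _ (here-step _ _) , there _ (there _ here-stop)))
    where
    q₂≢p₂ : proj₂ q ≢ proj₂ p
    q₂≢p₂ q₂≡p₂ = q≢p (×-≡,≡→≡ (q₁≡p₁ , q₂≡p₂))

    p₁≢r₁ : proj₁ p ≢ proj₁ r
    p₁≢r₁ p₁≡r₁ = r≢p (×-≡,≡→≡ (sym p₁≡r₁ , r₂≡p₂))

    ¬collinear : ¬ Collinear q r
    ¬collinear = [ (λ q₁≡r₁ → p₁≢r₁ (trans (sym q₁≡p₁) q₁≡r₁))
                 , (λ q₂≡r₂ → q₂≢p₂ (trans q₂≡r₂ r₂≡p₂)) ]′

    qpr : Walk q r
    qpr = step (inj₁ (q₁≡p₁ , q₂≢p₂)) (step (inj₂ (p₁≢r₁ , sym r₂≡p₂)) (stop r))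

  PuncturedCross : Fin n → Fin m → Vertex n m → Set
  PuncturedCross i j v = (proj₂ v ≡ j ⊎ proj₁ v ≡ i) × v ≢ (i , j)

  puncturedCross⇒lineAlone : ∀ {i j S} → (∀ {v} → v ∈ S → PuncturedCross i j v) → LineAlone S
  puncturedCross⇒lineAlone {i} {j} S⊆cross {p} p∈S with S⊆cross p∈S
  ... | inj₁ p₂≡j , p≢ij = inj₁ row-alone
    where
    row-alone : Alone proj₁ _ p
    row-alone q∈S q₁≡p₁ with S⊆cross q∈S
    ... | inj₁ q₂≡j , _ = ×-≡,≡→≡ (q₁≡p₁ , trans q₂≡j (sym p₂≡j))
    ... | inj₂ q₁≡i , _ = ⊥-elim (p≢ij (×-≡,≡→≡ (trans (sym q₁≡p₁) q₁≡i , p₂≡j)))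
  ... | inj₂ p₁≡i , p≢ij = inj₂ col-alone
    where
    col-alone : Alone proj₂ _ p
    col-alone q∈S q₂≡p₂ with S⊆cross q∈S
    ... | inj₂ q₁≡i , _ = ×-≡,≡→≡ (trans q₁≡i (sym p₁≡i) , q₂≡p₂)
    ... | inj₁ q₂≡j , _ = ⊥-elim (p≢ij (×-≡,≡→≡ (p₁≡i , trans (sym q₂≡p₂) q₂≡j)))

  puncturedCross⇒generalPosition : ∀ {i j S} → Unique S → (∀ {v} → v ∈ S → PuncturedCross i j v) →
                                   IsGeneralPosition S
  puncturedCross⇒generalPosition uS S⊆cross =
    lineAlone⇒generalPosition uS (puncturedCross⇒lineAlone S⊆cross)

module LineCount {n m} {X : List (Vertex n m)} (uX : Unique X) (lineAlone : LineAlone X) where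
  open DecMembership (⊎-≡-dec (_≟_ {n}) (_≟_ {m})) using (_∈?_)

  line : Vertex n m → Fin n ⊎ Fin m
  line p with rowMate? X p
  ... | no  _ = inj₁ (proj₁ p)
  ... | yes _ = inj₂ (proj₂ p)

  line-cases : ∀ p → Alone proj₁ X p × line p ≡ inj₁ (proj₁ p) ⊎
                     Mate proj₁ X p × line p ≡ inj₂ (proj₂ p)
  line-cases p with rowMate? X p
  ... | no  ¬rowMate = inj₁ (¬mate⇒alone proj₁ _≟ᵥ_ ¬rowMate , refl)
  ... | yes rowMate  = inj₂ (rowMate , refl)

  rowMate⇒colAlone : ∀ {p} → p ∈ X → Mate proj₁ X p → Alone proj₂ X p
  rowMate⇒colAlone p∈X rowMate = [ ⊥-elim ∘ mate⇒¬alone proj₁ rowMate , id ]′ (lineAlone p∈X)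

  line-injective : ∀ {p q} → p ∈ X → q ∈ X → line p ≡ line q → p ≡ q
  line-injective {p} {q} p∈X q∈X lp≡lq with line-cases p | line-cases q
  ... | inj₁ (p-alone , lp) | inj₁ (_ , lq) =
    sym (p-alone q∈X (sym (inj₁-injective (trans (sym lp) (trans lp≡lq lq)))))
  ... | inj₂ (p-mate , lp)  | inj₂ (_ , lq) =
    sym (rowMate⇒colAlone p∈X p-mate q∈X (sym (inj₂-injective (trans (sym lp) (trans lp≡lq lq)))))
  ... | inj₁ (_ , lp)       | inj₂ (_ , lq) with () ← trans (sym lp) (trans lp≡lq lq)
  ... | inj₂ (_ , lp)       | inj₁ (_ , lq) with () ← trans (sym lp) (trans lp≡lq lq)

  Unhit : Fin n ⊎ Fin m → Set
  Unhit ℓ = ℓ ∉ map line X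

  unhit-bound : ∀ {L} → Unique L → All Unhit L → length L + length X ≤ n + m
  unhit-bound {L} uL unhit = begin
    length L + length X             ≡⟨ cong (length L +_) (length-map line X) ⟨
    length L + length (map line X)  ≡⟨ length-++ L ⟨
    length (L ++ map line X)        ≤⟨ unique⊎⇒length≤ (Unique.++⁺ uL unique-lines disjoint) ⟩
    n + m                           ∎
    where
    open ≤-Reasoning
    unique-lines : Unique (map line X)
    unique-lines = map⁺-injectiveOn line-injective uX
    disjoint : ∀ {ℓ} → ¬ (ℓ ∈ L × ℓ ∈ map line X)
    disjoint (ℓ∈L , ℓ-hit) = All.lookup unhit ℓ∈L ℓ-hit

  hit-row : ∀ {r} → inj₁ r ∈ map line X → ∃[ q ] q ∈ X × Alone proj₁ X q × proj₁ q ≡ r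
  hit-row r-hit with q , q∈X , r≡lq ← ∈-map⁻ line r-hit with line-cases q
  ... | inj₁ (q-alone , lq) = q , q∈X , q-alone , sym (inj₁-injective (trans r≡lq lq))
  ... | inj₂ (_ , lq) with () ← trans r≡lq lq

  hit-col : ∀ {c} → inj₂ c ∈ map line X → ∃[ q ] q ∈ X × Mate proj₁ X q × proj₂ q ≡ c
  hit-col c-hit with q , q∈X , c≡lq ← ∈-map⁻ line c-hit with line-cases q
  ... | inj₂ (q-mate , lq) = q , q∈X , q-mate , sym (inj₂-injective (trans c≡lq lq))
  ... | inj₁ (_ , lq) with () ← trans c≡lq lq

  rowMate⇒row-unhit : ∀ {p} → p ∈ X → Mate proj₁ X p → Unhit (inj₁ (proj₁ p))
  rowMate⇒row-unhit p∈X p-mate row-hit with q , _ , q-alone , q₁≡p₁ ← hit-row row-hit =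
    mate⇒¬alone proj₁ p-mate (subst (Alone proj₁ X) (sym (q-alone p∈X (sym q₁≡p₁))) q-alone)

  rowAlone⇒col-unhit : ∀ {p} → p ∈ X → Alone proj₁ X p → Unhit (inj₂ (proj₂ p))
  rowAlone⇒col-unhit p∈X p-alone col-hit with q , q∈X , q-mate , q₂≡p₂ ← hit-col col-hit =
    mate⇒¬alone proj₁ q-mate
      (subst (Alone proj₁ X) (rowMate⇒colAlone q∈X q-mate p∈X (sym q₂≡p₂)) p-alone)

  empty-row-unhit : ∀ {r} → (∀ {q} → q ∈ X → proj₁ q ≢ r) → Unhit (inj₁ r)
  empty-row-unhit empty row-hit with _ , q∈X , _ , q₁≡r ← hit-row row-hit = empty q∈X q₁≡r

  no-rowMate⇒col-unhit : ∀ {c} → (∀ {q} → q ∈ X → ¬ Mate proj₁ X q) → Unhit (inj₂ c)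
  no-rowMate⇒col-unhit no-mate col-hit with _ , q∈X , q-mate , _ ← hit-col col-hit =
    no-mate q∈X q-mate

  row-or-col-unhit : ∀ r → Unhit (inj₁ r) ⊎ ∃[ c ] Unhit (inj₂ c)
  row-or-col-unhit r with inj₁ r ∈? map line X
  ... | no  row-unhit = inj₁ row-unhit
  ... | yes row-hit with q , q∈X , q-alone , _ ← hit-row row-hit
    = inj₂ (proj₂ q , rowAlone⇒col-unhit q∈X q-alone)

  row-or-col-hit : ∀ {p} → p ∈ X → Unhit (inj₁ (proj₁ p)) → Unhit (inj₂ (proj₂ p)) → ⊥
  row-or-col-hit {p} p∈X row-unhit col-unhit with line-cases p
  ... | inj₁ (_ , lp) = row-unhit (subst (_∈ map line X) lp (∈-map⁺ line p∈X))
  ... | inj₂ (_ , lp) = col-unhit (subst (_∈ map line X) lp (∈-map⁺ line p∈X))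

module Structure {n m} {X : List (Vertex (3 + n) (3 + m))} (uX : Unique X) (lineAlone : LineAlone X)
                 (large : 2 + n + (2 + m) ≤ length X) where
  open LineCount uX lineAlone

  no-three-unhit : ∀ {ℓ₁ ℓ₂ ℓ₃} → ℓ₁ ≢ ℓ₂ → ℓ₂ ≢ ℓ₃ → ℓ₁ ≢ ℓ₃ →
                   Unhit ℓ₁ → Unhit ℓ₂ → Unhit ℓ₃ → ⊥
  no-three-unhit ℓ₁≢ℓ₂ ℓ₂≢ℓ₃ ℓ₁≢ℓ₃ unhit₁ unhit₂ unhit₃ = 1+n≰n (begin
    3 + length X           ≤⟨ unhit-bound ((ℓ₁≢ℓ₂ ∷ ℓ₁≢ℓ₃ ∷ []) ∷ (ℓ₂≢ℓ₃ ∷ []) ∷ [] ∷ [])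
                                          (unhit₁ ∷ unhit₂ ∷ unhit₃ ∷ []) ⟩
    3 + n + (3 + m)        ≡⟨ cong (3 +_) (+-suc n (2 + m)) ⟩
    2 + (2 + n + (2 + m))  ≤⟨ s≤s (s≤s large) ⟩
    2 + length X           ∎)
    where open ≤-Reasoning

  off-row-alone : ∀ {i q} → Unhit (inj₁ i) → q ∈ X → proj₁ q ≢ i → Alone proj₁ X q
  off-row-alone {i} {q} i-unhit q∈X q₁≢i with rowMate? X q
  ... | no ¬rowMate = ¬mate⇒alone proj₁ _≟ᵥ_ ¬rowMate
  ... | yes q-mate with r , r≢i , r≢q₁ ← avoid₂ i (proj₁ q) with row-or-col-unhit r
  ...   | inj₁ r-unhit =
    ⊥-elim (no-three-unhit (inj₁-≢ (≢-sym q₁≢i)) (inj₁-≢ (≢-sym r≢q₁)) (inj₁-≢ (≢-sym r≢i))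
                           i-unhit (rowMate⇒row-unhit q∈X q-mate) r-unhit)
  ...   | inj₂ (_ , c-unhit) =
    ⊥-elim (no-three-unhit (inj₁-≢ (≢-sym q₁≢i)) (λ ()) (λ ())
                           i-unhit (rowMate⇒row-unhit q∈X q-mate) c-unhit)

  cross-through : ∀ {i} → Unhit (inj₁ i) → ∃[ j ] (∀ {v} → v ∈ X → PuncturedCross i j v)
  cross-through {i} i-unhit with any? (λ q → ¬? (proj₁ q ≟ i)) X
  ... | no none-off with r₁ , r₂ , i≢r₁ , r₁≢r₂ , i≢r₂ ← two-others i
    = ⊥-elim (no-three-unhit (inj₁-≢ i≢r₁) (inj₁-≢ r₁≢r₂) (inj₁-≢ i≢r₂)
                             i-unhit (empty (≢-sym i≢r₁)) (empty (≢-sym i≢r₂)))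
    where
    empty : ∀ {r} → r ≢ i → Unhit (inj₁ r)
    empty r≢i = empty-row-unhit λ q∈X q₁≡r →
      none-off (lose q∈X λ q₁≡i → r≢i (trans (sym q₁≡r) q₁≡i))
  ... | yes some-off with p , p∈X , p₁≢i ← find some-off
    = proj₂ p , λ q∈X → in-cross q∈X , ≢centre q∈X
    where
    j-unhit : Unhit (inj₂ (proj₂ p))
    j-unhit = rowAlone⇒col-unhit p∈X (off-row-alone i-unhit p∈X p₁≢i)

    in-cross : ∀ {q} → q ∈ X → proj₂ q ≡ proj₂ p ⊎ proj₁ q ≡ i
    in-cross {q} q∈X with proj₁ q ≟ i
    ... | yes q₁≡i = inj₂ q₁≡i
    ... | no  q₁≢i = inj₁ (decidable-stable (proj₂ q ≟ proj₂ p) λ q₂≢j →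
      no-three-unhit (λ ()) (inj₂-≢ q₂≢j) (λ ())
                     i-unhit (rowAlone⇒col-unhit q∈X (off-row-alone i-unhit q∈X q₁≢i)) j-unhit)

    ≢centre : ∀ {q} → q ∈ X → q ≢ (i , proj₂ p)
    ≢centre q∈X refl = row-or-col-hit q∈X i-unhit j-unhit

  puncturedCross : ∃[ i ] ∃[ j ] (∀ {v} → v ∈ X → PuncturedCross i j v)
  puncturedCross with any? (rowMate? X) X
  ... | yes some-mate with p , p∈X , p-mate ← find some-mate
    = proj₁ p , cross-through (rowMate⇒row-unhit p∈X p-mate)
  ... | no  none-mate with c₂ , c₃ , c₁≢c₂ , c₂≢c₃ , c₁≢c₃ ← two-others zero
    = ⊥-elim (no-three-unhit (inj₂-≢ c₁≢c₂) (inj₂-≢ c₂≢c₃) (inj₂-≢ c₁≢c₃) col-unhit col-unhit col-unhit)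
    where
    col-unhit : ∀ {c} → Unhit (inj₂ c)
    col-unhit = no-rowMate⇒col-unhit λ q∈X → none-mate ∘ lose q∈X

module _ (n m : ℕ) where

  column-arm row-arm puncturedCrossList : List (Vertex (suc n) (suc m))
  column-arm         = map (λ a → suc a , zero) (allFin n)
  row-arm            = map (λ b → zero , suc b) (allFin m)
  puncturedCrossList = column-arm ++ row-arm

  puncturedCrossList⊆ : ∀ {v} → v ∈ puncturedCrossList → PuncturedCross zero zero v
  puncturedCrossList⊆ v∈ with ∈-++⁻ column-arm v∈
  ... | inj₁ v∈col with _ , _ , refl ← ∈-map⁻ _ v∈col = inj₁ refl , λ ()
  ... | inj₂ v∈row with _ , _ , refl ← ∈-map⁻ _ v∈row = inj₂ refl , λ ()

  puncturedCrossList-unique : Unique puncturedCrossList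
  puncturedCrossList-unique =
    Unique.++⁺ (Unique.map⁺ (suc-injective ∘ cong proj₁) (Unique.allFin⁺ n))
               (Unique.map⁺ (suc-injective ∘ cong proj₂) (Unique.allFin⁺ m))
               disjoint
    where
    disjoint : ∀ {v} → ¬ (v ∈ column-arm × v ∈ row-arm)
    disjoint (v∈col , v∈row) with _ , _ , refl ← ∈-map⁻ _ v∈col with _ , _ , () ← ∈-map⁻ _ v∈row

  length-puncturedCrossList : length puncturedCrossList ≡ n + m
  length-puncturedCrossList = begin
    length puncturedCrossList              ≡⟨ length-++ column-arm ⟩
    length column-arm + length row-arm     ≡⟨ cong₂ _+_ (length-map _ (allFin n)) (length-map _ (allFin m)) ⟩
    length (allFin n) + length (allFin m)  ≡⟨ cong₂ _+_ (length-allFin n) (length-allFin m) ⟩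
    n + m                                  ∎
    where open ≡-Reasoning

n+m≤length-maxGeneralPosition : ∀ {n m} {X : List (Vertex (suc n) (suc m))} →
                                IsMaxGeneralPosition X → n + m ≤ length X
n+m≤length-maxGeneralPosition {n} {m} {X} (_ , maximum) =
  subst (_≤ length X) (length-puncturedCrossList n m)
    (maximum _ (puncturedCross⇒generalPosition (puncturedCrossList-unique n m)
                                               (puncturedCrossList⊆ n m)))

maximum⇒saturated : ∀ {n m} {X : List (Vertex n m)} (P : Vertex n m → Set) →
                    (∀ {S} → Unique S → (∀ {v} → v ∈ S → P v) → IsGeneralPosition S) →
                    IsMaxGeneralPosition X → (∀ {v} → v ∈ X → P v) → ∀ {v} → P v → v ∈ X
maximum⇒saturated {X = X} P P⇒generalPosition ((uX , _) , maximum) X⊆P {v} Pv =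
  decidable-stable (v ∈? X) λ v∉X →
    1+n≰n (maximum (v ∷ X) (P⇒generalPosition (All.tabulate (λ { x∈X refl → v∉X x∈X }) ∷ uX) vX⊆P))
  where
  open DecMembership _≟ᵥ_ using (_∈?_)
  vX⊆P : ∀ {w} → w ∈ v ∷ X → P w
  vX⊆P (here refl) = Pv
  vX⊆P (there w∈X) = X⊆P w∈X

lemma2p3 : (n m : ℕ) → 3 ≤ n → 3 ≤ m → (X : List (Vertex n m)) →
    IsMaxGeneralPosition X →
    Σ (Fin n) λ i → Σ (Fin m) λ j → (v : Vertex n m) →
      (v ∈ X ⇔ ((proj₂ v ≡ j ⊎ proj₁ v ≡ i) × v ≢ (i , j)))
lemma2p3 (suc (suc (suc n))) (suc (suc (suc m))) (s≤s (s≤s (s≤s _))) (s≤s (s≤s (s≤s _))) X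
         max@(gpX , _)
  with i , j , X⊆cross ← Structure.puncturedCross (proj₁ gpX) (generalPosition⇒lineAlone gpX)
                                                  (n+m≤length-maxGeneralPosition max)
  = i , j , λ v → mk⇔ X⊆cross
      (maximum⇒saturated (PuncturedCross i j) puncturedCross⇒generalPosition max X⊆cross)
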